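{- Let $\lambda\neq1$ be a complex number and $n$ a nonnegative integer. Then \[ \sum_{j=0}^{n}(-1)^{j}Y_{j}(\lambda)Y_{n-j}(\lambda)=\frac{4\lambda^{2n}\left(1+(-1)^{n}\right)(n+1)!}{(n+2)(\lambda-1)^{n+2}}. \]
   Context: For a complex number $\lambda\neq 1$, the numbers $Y_n(\lambda)$ are defined by the expansion (as formal power series in $t$) \[ \frac{2}{\lambda(1+\lambda t)-1}=\sum_{n=0}^{\infty}Y_{n}(\lambda)\frac{t^{n}}{n!}. \] -}

module Defs where

open import Level using (Level; _⊔_) renaming (suc to lsuc)
open import Data.Nat using (ℕ; zero; suc; _∸_)
open import Relation.Nullary using (¬_)
open import Algebra.Bundles using (CommutativeRing)

-- A field, in the style of a total inverse function: x ⁻¹ is only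
-- constrained for x ≉ 0.  (agda-stdlib 2.3 has no Field bundle.)
record Field (c ℓ : Level) : Set (lsuc (c ⊔ ℓ)) where
  field
    commutativeRing : CommutativeRing c ℓ
  open CommutativeRing commutativeRing public
  field
    _⁻¹      : Carrier → Carrier
    ⁻¹-cong  : ∀ {x y} → x ≈ y → x ⁻¹ ≈ y ⁻¹
    inverseʳ : ∀ x → ¬ (x ≈ 0#) → x * (x ⁻¹) ≈ 1#
    0≉1      : ¬ (0# ≈ 1#)

  infixl 7 _/_
  _/_ : Carrier → Carrier → Carrier
  x / y = x * (y ⁻¹)

  infixr 8 _^_
  _^_ : Carrier → ℕ → Carrier
  x ^ zero  = 1#
  x ^ suc n = x * (x ^ n)

  ι : ℕ → Carrier
  ι zero    = 0#
  ι (suc n) = 1# + ι n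

  fact : ℕ → Carrier
  fact zero    = 1#
  fact (suc n) = ι (suc n) * fact n

  sumTo : ℕ → (ℕ → Carrier) → Carrier
  sumTo zero    f = f 0
  sumTo (suc n) f = sumTo n f + f (suc n)

  Series : Set c
  Series = ℕ → Carrier

  constS : Carrier → Series
  constS a zero    = a
  constS a (suc _) = 0#

  tS : Series
  tS zero          = 0#
  tS (suc zero)    = 1#
  tS (suc (suc _)) = 0#

  _⊕_ : Series → Series → Series
  (f ⊕ g) n = f n + g n

  _⊖_ : Series → Series → Series
  (f ⊖ g) n = f n - g n

  _⊛_ : Series → Series → Series
  (f ⊛ g) n = sumTo n (λ k → f k * g (n ∸ k))

  _≐_ : Series → Series → Set ℓ
  f ≐ g = ∀ n → f n ≈ g n

  egf : (ℕ → Carrier) → Series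
  egf Y n = Y n / fact n

  denomS : Carrier → Series
  denomS lam = (constS lam ⊛ (constS 1# ⊕ (constS lam ⊛ tS))) ⊖ constS 1#

  -- Y is the sequence defined by
  --   2 / (λ(1+λt) − 1) = Σ Y n tⁿ / n!   (as formal power series),
  -- i.e. (λ(1+λt) − 1) · Σ Y n tⁿ/n! = 2.
  IsYSeq : Carrier → (ℕ → Carrier) → Set ℓ
  IsYSeq lam Y = (denomS lam ⊛ egf Y) ≐ constS (1# + 1#)

CharZero : ∀ {c ℓ} → Field c ℓ → Set ℓ
CharZero F = ∀ n → ¬ (ι (suc n) ≈ 0#)
  where open Field F

module Submission where

-- Write d = λ − 1 and yₙ = Yₙ/n!.  The denominator series has only the two
-- nonzero coefficients d and λ², so comparing coefficients gives d·y₀ = 2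
-- and d·yₙ₊₁ = −λ²·yₙ; solving this first-order recurrence yields the closed
-- form dⁿ⁺¹·Yₙ = 2·(−λ²)ⁿ·n!.  Substituting it into the sum gives
--   dⁿ⁺²·Σⱼ (−1)ʲ YⱼYₙ₋ⱼ = 4·(−λ²)ⁿ·Σⱼ (−1)ʲ j!(n−j)!.
-- The remaining factorial sum telescopes: with Tⱼ = j!(n+1−j)! we have
-- (n+2)·j!(n−j)! = Tⱼ + Tⱼ₊₁, hence (n+2)·Σⱼ (−1)ʲ j!(n−j)! = (1+(−1)ⁿ)(n+1)!.
-- Finally (−λ²)ⁿ(1+(−1)ⁿ) = λ²ⁿ(1+(−1)ⁿ), and (n+2)·dⁿ⁺² is invertible
-- (characteristic zero and λ ≠ 1), which gives the theorem.

open import Defs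
open import Data.Nat using (ℕ; suc; _∸_) renaming (_+_ to _+ℕ_; _*_ to _*ℕ_)
open import Relation.Nullary using (¬_)
open import Data.Nat using (zero; _≤_; z≤n)
import Data.Nat.Properties as ℕₚ
open import Relation.Binary.PropositionalEquality as ≡ using (_≡_; cong)

-- Splitting n + 2 as (j + 1) + (n − j + 1), used to distribute the
-- exponent n + 2 and the weight n + 2 over the two factors of a product.
split-index : ∀ {j n} → j ≤ n → suc (suc n) ≡ suc j +ℕ suc (n ∸ j)
split-index {j} {n} j≤n =
  cong suc (≡.sym (≡.trans (ℕₚ.+-suc j (n ∸ j)) (cong suc (ℕₚ.m+[n∸m]≡n j≤n))))

module _ {c ℓ} (F : Field c ℓ) where
  open Field F
  open import Relation.Binary.Reasoning.Setoid setoid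
  open import Algebra.Properties.Ring ring using (-1*x≈-x; -‿distribˡ-*; -‿involutive; -0#≈0#)
  open import Algebra.Properties.CommutativeSemigroup *-commutativeSemigroup
    using (interchange; x∙yz≈y∙xz; xy∙z≈x∙zy; xy∙z≈y∙xz)
  import Algebra.Properties.CommutativeSemiring.Exp commutativeSemiring as Exp
  import Algebra.Properties.Semiring.Mult semiring as Mult
  open import Algebra.Properties.Group +-group using (\\-leftDividesˡ; inverseˡ-unique; x∙y⁻¹≈ε⇒x≈y)

  sign : ℕ → Carrier
  sign j = (- 1#) ^ j

  two : Carrier
  two = 1# + 1#

  sumTo-cong : ∀ n {f g : ℕ → Carrier} → (∀ j → j ≤ n → f j ≈ g j) → sumTo n f ≈ sumTo n g
  sumTo-cong zero    f≈g = f≈g 0 z≤n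
  sumTo-cong (suc n) f≈g =
    +-cong (sumTo-cong n (λ j j≤n → f≈g j (ℕₚ.m≤n⇒m≤1+n j≤n))) (f≈g (suc n) ℕₚ.≤-refl)

  sumTo-distribˡ : ∀ n k (f : ℕ → Carrier) → k * sumTo n f ≈ sumTo n (λ j → k * f j)
  sumTo-distribˡ zero    k f = refl
  sumTo-distribˡ (suc n) k f = trans (distribˡ k (sumTo n f) (f (suc n))) (+-congʳ (sumTo-distribˡ n k f))

  alternating-telescope : ∀ m (T : ℕ → Carrier) →
    sumTo m (λ j → sign j * (T j + T (suc j))) ≈ T 0 + sign m * T (suc m)
  alternating-telescope zero    T = trans (*-identityˡ _) (+-congˡ (sym (*-identityˡ _)))
  alternating-telescope (suc m) T = begin
    sumTo m (λ j → sign j * (T j + T (suc j))) + sign (suc m) * (T₁ + T₂)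
      ≈⟨ +-cong (alternating-telescope m T) (*-congʳ (-1*x≈-x (sign m))) ⟩
    (T 0 + sign m * T₁) + (- sign m) * (T₁ + T₂)
      ≈⟨ +-congˡ (trans (distribˡ _ _ _) (+-congʳ (sym (-‿distribˡ-* (sign m) T₁)))) ⟩
    (T 0 + sign m * T₁) + (- (sign m * T₁) + (- sign m) * T₂)
      ≈⟨ +-assoc _ _ _ ⟩
    T 0 + (sign m * T₁ + (- (sign m * T₁) + (- sign m) * T₂))
      ≈⟨ +-congˡ (\\-leftDividesˡ (sign m * T₁) _) ⟩
    T 0 + (- sign m) * T₂
      ≈⟨ +-congˡ (*-congʳ (sym (-1*x≈-x (sign m)))) ⟩
    T 0 + sign (suc m) * T₂ ∎
    where
    T₁ T₂ : Carrier
    T₁ = T (suc m)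
    T₂ = T (suc (suc m))

  -- The field's power function agrees with the standard library's monoid
  -- power, so the library's exponent laws apply to it.
  ^≈Exp-^ : ∀ x n → x ^ n ≈ x Exp.^ n
  ^≈Exp-^ x zero    = refl
  ^≈Exp-^ x (suc n) = *-congˡ (^≈Exp-^ x n)

  ^-congˡ : ∀ {x y} n → x ≈ y → x ^ n ≈ y ^ n
  ^-congˡ {x} {y} n x≈y = trans (^≈Exp-^ x n) (trans (Exp.^-congˡ n x≈y) (sym (^≈Exp-^ y n)))

  ^-homo-+ : ∀ x m n → x ^ (m +ℕ n) ≈ x ^ m * x ^ n
  ^-homo-+ x m n = trans (^≈Exp-^ x (m +ℕ n))
    (trans (Exp.^-homo-* x m n) (sym (*-cong (^≈Exp-^ x m) (^≈Exp-^ x n))))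

  ^-distrib-* : ∀ x y n → (x * y) ^ n ≈ x ^ n * y ^ n
  ^-distrib-* x y n = trans (^≈Exp-^ (x * y) n)
    (trans (Exp.^-distrib-* x y n) (sym (*-cong (^≈Exp-^ x n) (^≈Exp-^ y n))))

  -- (−1)ⁿ squares to 1, so it fixes 1 + (−1)ⁿ.
  sign-fixes-1+sign : ∀ n → sign n * (1# + sign n) ≈ 1# + sign n
  sign-fixes-1+sign n = begin
    sign n * (1# + sign n)       ≈⟨ distribˡ _ _ _ ⟩
    sign n * 1# + sign n * sign n ≈⟨ +-cong (*-identityʳ _) (sym (^-distrib-* (- 1#) (- 1#) n)) ⟩
    sign n + (- 1# * - 1#) ^ n   ≈⟨ +-congˡ (^-congˡ n (trans (-1*x≈-x (- 1#)) (-‿involutive 1#))) ⟩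
    sign n + 1# ^ n              ≈⟨ +-congˡ (one^ n) ⟩
    sign n + 1#                  ≈⟨ +-comm _ _ ⟩
    1# + sign n                  ∎
    where
    one^ : ∀ k → 1# ^ k ≈ 1#
    one^ zero    = refl
    one^ (suc k) = trans (*-identityˡ _) (one^ k)

  neg-square-power : ∀ x n → (- (x * x)) ^ n * (1# + sign n) ≈ x ^ (2 *ℕ n) * (1# + sign n)
  neg-square-power x n = begin
    (- (x * x)) ^ n * (1# + sign n)          ≈⟨ *-congʳ (^-congˡ n (sym (-1*x≈-x (x * x)))) ⟩
    (- 1# * (x * x)) ^ n * (1# + sign n)     ≈⟨ *-congʳ (^-distrib-* (- 1#) (x * x) n) ⟩
    (sign n * (x * x) ^ n) * (1# + sign n)   ≈⟨ xy∙z≈y∙xz (sign n) _ _ ⟩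
    (x * x) ^ n * (sign n * (1# + sign n))   ≈⟨ *-cong square-power (sign-fixes-1+sign n) ⟩
    x ^ (2 *ℕ n) * (1# + sign n)             ∎
    where
    square-power : (x * x) ^ n ≈ x ^ (2 *ℕ n)
    square-power = trans (^-distrib-* x x n)
      (trans (sym (^-homo-+ x n n)) (reflexive (cong (λ m → x ^ (n +ℕ m)) (≡.sym (ℕₚ.+-identityʳ n)))))

  ι≈×1 : ∀ n → ι n ≈ n Mult.× 1#
  ι≈×1 zero    = refl
  ι≈×1 (suc n) = +-congˡ (ι≈×1 n)

  ι-homo-+ : ∀ m n → ι (m +ℕ n) ≈ ι m + ι n
  ι-homo-+ m n = trans (ι≈×1 (m +ℕ n)) (trans (Mult.×-homo-+ 1# m n) (sym (+-cong (ι≈×1 m) (ι≈×1 n))))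

  ι4≈two*two : ι 4 ≈ two * two
  ι4≈two*two = trans (ι≈×1 4) (trans (Mult.×1-homo-* 2 2) (*-cong ι2≈two ι2≈two))
    where
    ι2≈two : 2 Mult.× 1# ≈ two
    ι2≈two = +-congˡ (+-identityʳ 1#)

  *-nonzero : ∀ {x y} → ¬ (x ≈ 0#) → ¬ (y ≈ 0#) → ¬ (x * y ≈ 0#)
  *-nonzero {x} {y} x≉0 y≉0 xy≈0 = y≉0 (begin
    y                ≈⟨ sym (*-identityˡ y) ⟩
    1# * y           ≈⟨ *-congʳ (sym (inverseʳ x x≉0)) ⟩
    (x * x ⁻¹) * y   ≈⟨ xy∙z≈x∙zy x (x ⁻¹) y ⟩
    x * (y * x ⁻¹)   ≈⟨ sym (*-assoc x y (x ⁻¹)) ⟩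
    (x * y) * x ⁻¹   ≈⟨ *-congʳ xy≈0 ⟩
    0# * x ⁻¹        ≈⟨ zeroˡ _ ⟩
    0#               ∎)

  ^-nonzero : ∀ {x} n → ¬ (x ≈ 0#) → ¬ (x ^ n ≈ 0#)
  ^-nonzero zero    x≉0 1≈0 = 0≉1 (sym 1≈0)
  ^-nonzero (suc n) x≉0     = *-nonzero x≉0 (^-nonzero n x≉0)

  divide-through : ∀ {x z w} → ¬ (z ≈ 0#) → z * x ≈ w → x ≈ w / z
  divide-through {x} {z} {w} z≉0 zx≈w = begin
    x              ≈⟨ sym (*-identityʳ x) ⟩
    x * 1#         ≈⟨ *-congˡ (sym (inverseʳ z z≉0)) ⟩
    x * (z * z ⁻¹) ≈⟨ sym (*-assoc x z (z ⁻¹)) ⟩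
    (x * z) * z ⁻¹ ≈⟨ *-congʳ (trans (*-comm x z) zx≈w) ⟩
    w * z ⁻¹       ∎

  constS-⊛ : ∀ a (h : Series) n → (constS a ⊛ h) n ≈ a * h n
  constS-⊛ a h n = leading-term n (λ k → h (n ∸ k))
    where
    leading-term : ∀ m (f : ℕ → Carrier) → sumTo m (λ k → constS a k * f k) ≈ a * f 0
    leading-term zero    f = refl
    leading-term (suc m) f = trans (+-cong (leading-term m f) (zeroˡ _)) (+-identityʳ _)

  ⊛-two-term : (D f : Series) → (∀ k → D (suc (suc k)) ≈ 0#) →
    ∀ n → (D ⊛ f) (suc n) ≈ D 0 * f (suc n) + D 1 * f n
  ⊛-two-term D f D≥2≈0 n = first-two n (λ k → f (suc n ∸ k))
    where
    first-two : ∀ m (g : ℕ → Carrier) → sumTo (suc m) (λ k → D k * g k) ≈ D 0 * g 0 + D 1 * g 1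
    first-two zero    g = refl
    first-two (suc m) g =
      trans (+-cong (first-two m g) (trans (*-congʳ (D≥2≈0 m)) (zeroˡ _))) (+-identityʳ _)

  module Denominator (lam : Carrier) where

    d : Carrier
    d = lam - 1#

    d-nonzero : ¬ (lam ≈ 1#) → ¬ (d ≈ 0#)
    d-nonzero lam≉1 d≈0 = lam≉1 (x∙y⁻¹≈ε⇒x≈y lam 1# d≈0)

    denomS≈ : ∀ k → denomS lam k ≈ lam * (constS 1# k + lam * tS k) - constS 1# k
    denomS≈ k = +-congʳ (trans (constS-⊛ lam (constS 1# ⊕ (constS lam ⊛ tS)) k) (*-congˡ (+-congˡ (constS-⊛ lam tS k))))

    denomS-0 : denomS lam 0 ≈ d
    denomS-0 = trans (denomS≈ 0)
      (+-congʳ (trans (*-congˡ (trans (+-congˡ (zeroʳ lam)) (+-identityʳ 1#))) (*-identityʳ lam)))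

    denomS-1 : denomS lam 1 ≈ lam * lam
    denomS-1 = trans (denomS≈ 1)
      (trans (+-cong (*-congˡ (trans (+-identityˡ _) (*-identityʳ lam))) -0#≈0#)
             (+-identityʳ _))

    denomS-≥2 : ∀ k → denomS lam (suc (suc k)) ≈ 0#
    denomS-≥2 k = trans (denomS≈ (suc (suc k)))
      (trans (+-cong (trans (*-congˡ (trans (+-identityˡ _) (zeroʳ lam))) (zeroʳ lam)) -0#≈0#)
             (+-identityʳ _))

  linear-recurrence-solution : ∀ {d a q} (y : ℕ → Carrier) →
    d * y 0 ≈ a → (∀ n → d * y (suc n) ≈ q * y n) → ∀ n → d ^ suc n * y n ≈ a * q ^ n
  linear-recurrence-solution {d} {a} y init step zero =
    trans (*-congʳ (*-identityʳ d)) (trans init (sym (*-identityʳ a)))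
  linear-recurrence-solution {d} {a} {q} y init step (suc n) = begin
    (d * d ^ suc n) * y (suc n) ≈⟨ *-congʳ (*-comm d _) ⟩
    (d ^ suc n * d) * y (suc n) ≈⟨ *-assoc _ _ _ ⟩
    d ^ suc n * (d * y (suc n)) ≈⟨ *-congˡ (step n) ⟩
    d ^ suc n * (q * y n)       ≈⟨ x∙yz≈y∙xz _ q (y n) ⟩
    q * (d ^ suc n * y n)       ≈⟨ *-congˡ (linear-recurrence-solution y init step n) ⟩
    q * (a * q ^ n)             ≈⟨ x∙yz≈y∙xz q a _ ⟩
    a * (q * q ^ n)             ∎

  fact-split : ∀ a b → ι (suc a +ℕ suc b) * (fact a * fact b) ≈ fact a * fact (suc b) + fact (suc a) * fact b
  fact-split a b = begin
    ι (suc a +ℕ suc b) * (fact a * fact b)          ≈⟨ *-congʳ (trans (ι-homo-+ (suc a) (suc b)) (+-comm _ _)) ⟩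
    (ι (suc b) + ι (suc a)) * (fact a * fact b)     ≈⟨ distribʳ _ _ _ ⟩
    ι (suc b) * (fact a * fact b) + ι (suc a) * (fact a * fact b)
      ≈⟨ +-cong (x∙yz≈y∙xz _ _ _) (sym (*-assoc _ _ _)) ⟩
    fact a * fact (suc b) + fact (suc a) * fact b   ∎

  alternating-factorial-sum : ∀ n →
    ι (suc (suc n)) * sumTo n (λ j → sign j * (fact j * fact (n ∸ j))) ≈ (1# + sign n) * fact (suc n)
  alternating-factorial-sum n = begin
    ι (suc (suc n)) * sumTo n (λ j → sign j * (fact j * fact (n ∸ j)))
      ≈⟨ sumTo-distribˡ n _ _ ⟩
    sumTo n (λ j → ι (suc (suc n)) * (sign j * (fact j * fact (n ∸ j))))
      ≈⟨ sumTo-cong n split-term ⟩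
    sumTo n (λ j → sign j * (T j + T (suc j)))
      ≈⟨ alternating-telescope n T ⟩
    T 0 + sign n * T (suc n)
      ≈⟨ +-cong (*-identityˡ _) (*-congˡ (trans (*-congˡ (reflexive (cong fact (ℕₚ.n∸n≡0 n)))) (*-identityʳ _))) ⟩
    fact (suc n) + sign n * fact (suc n)
      ≈⟨ +-congʳ (sym (*-identityˡ _)) ⟩
    1# * fact (suc n) + sign n * fact (suc n)
      ≈⟨ sym (distribʳ _ _ _) ⟩
    (1# + sign n) * fact (suc n) ∎
    where
    T : ℕ → Carrier
    T j = fact j * fact (suc n ∸ j)

    split-term : ∀ j → j ≤ n →
      ι (suc (suc n)) * (sign j * (fact j * fact (n ∸ j))) ≈ sign j * (T j + T (suc j))
    split-term j j≤n = trans (x∙yz≈y∙xz _ _ _) (*-congˡ (begin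
      ι (suc (suc n)) * (fact j * fact (n ∸ j))          ≈⟨ *-congʳ (reflexive (cong ι (split-index j≤n))) ⟩
      ι (suc j +ℕ suc (n ∸ j)) * (fact j * fact (n ∸ j)) ≈⟨ fact-split j (n ∸ j) ⟩
      fact j * fact (suc (n ∸ j)) + T (suc j)
        ≈⟨ +-congʳ (*-congˡ (reflexive (cong fact (≡.sym (ℕₚ.+-∸-assoc 1 j≤n))))) ⟩
      T j + T (suc j)                                    ∎))

  module _ (cz : CharZero F) where

    fact-nonzero : ∀ n → ¬ (fact n ≈ 0#)
    fact-nonzero zero    1≈0 = 0≉1 (sym 1≈0)
    fact-nonzero (suc n)     = *-nonzero (cz n) (fact-nonzero n)

    egf-coefficient : ∀ (Y : ℕ → Carrier) n → Y n ≈ egf Y n * fact n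
    egf-coefficient Y n = begin
      Y n                           ≈⟨ sym (*-identityʳ (Y n)) ⟩
      Y n * 1#                      ≈⟨ *-congˡ (sym (inverseʳ (fact n) (fact-nonzero n))) ⟩
      Y n * (fact n * fact n ⁻¹)    ≈⟨ sym (xy∙z≈x∙zy (Y n) (fact n ⁻¹) (fact n)) ⟩
      (Y n * fact n ⁻¹) * fact n    ∎

    module _ (lam : Carrier) (Y : ℕ → Carrier) (isY : IsYSeq lam Y) where
      open Denominator lam

      ratio : Carrier
      ratio = - (lam * lam)

      egf-initial : d * egf Y 0 ≈ two
      egf-initial = trans (*-congʳ (sym denomS-0)) (isY 0)

      egf-step : ∀ n → d * egf Y (suc n) ≈ ratio * egf Y n
      egf-step n = trans (inverseˡ-unique _ _ coefficient-vanishes) (-‿distribˡ-* (lam * lam) (egf Y n))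
        where
        coefficient-vanishes : d * egf Y (suc n) + (lam * lam) * egf Y n ≈ 0#
        coefficient-vanishes = begin
          d * egf Y (suc n) + (lam * lam) * egf Y n
            ≈⟨ +-cong (*-congʳ (sym denomS-0)) (*-congʳ (sym denomS-1)) ⟩
          denomS lam 0 * egf Y (suc n) + denomS lam 1 * egf Y n
            ≈⟨ sym (⊛-two-term (denomS lam) (egf Y) denomS-≥2 n) ⟩
          (denomS lam ⊛ egf Y) (suc n)
            ≈⟨ isY (suc n) ⟩
          0# ∎

      Y-closed-form : ∀ n → d ^ suc n * Y n ≈ two * ratio ^ n * fact n
      Y-closed-form n = begin
        d ^ suc n * Y n                ≈⟨ *-congˡ (egf-coefficient Y n) ⟩
        d ^ suc n * (egf Y n * fact n) ≈⟨ sym (*-assoc _ _ _) ⟩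
        (d ^ suc n * egf Y n) * fact n ≈⟨ *-congʳ (linear-recurrence-solution (egf Y) egf-initial egf-step n) ⟩
        two * ratio ^ n * fact n       ∎

      convolution-closed-form : ∀ n →
        d ^ suc (suc n) * sumTo n (λ j → sign j * (Y j * Y (n ∸ j)))
          ≈ (two * two) * ratio ^ n * sumTo n (λ j → sign j * (fact j * fact (n ∸ j)))
      convolution-closed-form n = begin
        d ^ suc (suc n) * sumTo n (λ j → sign j * (Y j * Y (n ∸ j)))
          ≈⟨ sumTo-distribˡ n _ _ ⟩
        sumTo n (λ j → d ^ suc (suc n) * (sign j * (Y j * Y (n ∸ j))))
          ≈⟨ sumTo-cong n term ⟩
        sumTo n (λ j → (two * two) * ratio ^ n * (sign j * (fact j * fact (n ∸ j))))
          ≈⟨ sym (sumTo-distribˡ n _ _) ⟩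
        (two * two) * ratio ^ n * sumTo n (λ j → sign j * (fact j * fact (n ∸ j))) ∎
        where
        term : ∀ j → j ≤ n → d ^ suc (suc n) * (sign j * (Y j * Y (n ∸ j)))
                             ≈ (two * two) * ratio ^ n * (sign j * (fact j * fact (n ∸ j)))
        term j j≤n = begin
          d ^ suc (suc n) * (sign j * (Y j * Y k))
            ≈⟨ *-congʳ (trans (reflexive (cong (d ^_) (split-index j≤n))) (^-homo-+ d (suc j) (suc k))) ⟩
          (d ^ suc j * d ^ suc k) * (sign j * (Y j * Y k))
            ≈⟨ trans (x∙yz≈y∙xz _ _ _) (*-congˡ (interchange _ _ _ _)) ⟩
          sign j * ((d ^ suc j * Y j) * (d ^ suc k * Y k))
            ≈⟨ *-congˡ (*-cong (Y-closed-form j) (Y-closed-form k)) ⟩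
          sign j * ((two * ratio ^ j * fact j) * (two * ratio ^ k * fact k))
            ≈⟨ *-congˡ (trans (interchange _ _ _ _) (*-congʳ (interchange _ _ _ _))) ⟩
          sign j * ((two * two) * (ratio ^ j * ratio ^ k) * (fact j * fact k))
            ≈⟨ *-congˡ (*-congʳ (*-congˡ powers-combine)) ⟩
          sign j * ((two * two) * ratio ^ n * (fact j * fact k))
            ≈⟨ x∙yz≈y∙xz _ _ _ ⟩
          (two * two) * ratio ^ n * (sign j * (fact j * fact k)) ∎
          where
          k : ℕ
          k = n ∸ j

          powers-combine : ratio ^ j * ratio ^ k ≈ ratio ^ n
          powers-combine = trans (sym (^-homo-+ ratio j k)) (reflexive (cong (ratio ^_) (ℕₚ.m+[n∸m]≡n j≤n)))

      cleared-convolution : ∀ n →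
        (ι (suc (suc n)) * d ^ suc (suc n)) * sumTo n (λ j → sign j * (Y j * Y (n ∸ j)))
          ≈ ι 4 * lam ^ (2 *ℕ n) * (1# + sign n) * fact (suc n)
      cleared-convolution n = begin
        (I * d ^ suc (suc n)) * S              ≈⟨ *-assoc _ _ _ ⟩
        I * (d ^ suc (suc n) * S)              ≈⟨ *-congˡ (convolution-closed-form n) ⟩
        I * ((two * two) * ratio ^ n * A)      ≈⟨ x∙yz≈y∙xz _ _ _ ⟩
        (two * two) * ratio ^ n * (I * A)      ≈⟨ *-congˡ (alternating-factorial-sum n) ⟩
        (two * two) * ratio ^ n * ((1# + sign n) * fact (suc n))
          ≈⟨ trans (sym (*-assoc _ _ _)) (*-congʳ (*-assoc _ _ _)) ⟩
        (two * two) * (ratio ^ n * (1# + sign n)) * fact (suc n)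
          ≈⟨ *-congʳ (*-cong (sym ι4≈two*two) (neg-square-power lam n)) ⟩
        ι 4 * (lam ^ (2 *ℕ n) * (1# + sign n)) * fact (suc n)
          ≈⟨ *-congʳ (sym (*-assoc _ _ _)) ⟩
        ι 4 * lam ^ (2 *ℕ n) * (1# + sign n) * fact (suc n) ∎
        where
        I S A : Carrier
        I = ι (suc (suc n))
        S = sumTo n (λ j → sign j * (Y j * Y (n ∸ j)))
        A = sumTo n (λ j → sign j * (fact j * fact (n ∸ j)))

mainTheorem4 : ∀ {c ℓ} (F : Field c ℓ) → CharZero F →
    let open Field F in
    (lam : Carrier) → ¬ (lam ≈ 1#) →
    (Y : ℕ → Carrier) → IsYSeq lam Y →
    (n : ℕ) →
    sumTo n (λ j → ((- 1#) ^ j) * (Y j * Y (n ∸ j)))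
    ≈ ((ι 4 * (lam ^ (2 *ℕ n)) * (1# + (- 1#) ^ n) * fact (n +ℕ 1))
    / (ι (n +ℕ 2) * ((lam - 1#) ^ (n +ℕ 2))))
mainTheorem4 F cz lam lam≉1 Y isY n rewrite ℕₚ.+-comm n 2 | ℕₚ.+-comm n 1 =
  divide-through F (*-nonzero F (cz (suc n)) (^-nonzero F (suc (suc n)) (Denominator.d-nonzero F lam lam≉1)))
                   (cleared-convolution F cz lam Y isY n)
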